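{- Let $G_4=(V,E)$ be a finite digraph whose vertex set is partitioned as $V=V_1\cup W_1$ with $V_1\cap W_1=\varnothing$, $V_1=\{v_1,\dots,v_n\}$, $W_1=\{w_1,\dots,w_m\}$, such that for every $v\in V_1$ and every $w\in W_1$ there is exactly one directed edge $(v,w)\in E$, and $d_{\mathrm{out}}(w)=0$ for every $w\in W_1$. Suppose $m=|W_1|$ is even. Consider the auxiliary impartial game (normal play) whose positions are tuples $(x_1,\dots,x_n)$ of non-negative integers (tokens on $v_1,\dots,v_n$), in which a move consists of choosing some $v_i\in V_1$, removing at least $d_{\mathrm{out}}(v_i)+1$ tokens from $v_i$, where $d_{\mathrm{out}}(v_i)$ is the out-degree of $v_i$ in $G_4$ (counting its out-neighbours in both $V_1$ and $W_1$), and adding one token to each $v_j\in V_1$ with $(v_i,v_j)\in E$ (no tokens are placed on or removed from vertices of $W_1$). Let $S_{\mathcal P}$ and $S_{\mathcal N}$ be the sets of $\mathcal{P}$-positions and $\mathcal{N}$-positions of this auxiliary game. Then, for Digraph Yama Nim on $G_4$ with positions written as $(x_1,\dots,x_n,y_1,\dots,y_m)$ ($x_i$ tokens on $v_i$, $y_j$ tokens on $w_j$), the set of $\mathcal{P}$-positions is $S_1\cup S_2$, where $$S_1=\{(x_1,\dots,x_n,y_1,\dots,y_m)\mid (x_1,\dots,x_n)\in S_{\mathcal P}\text{ and } y_1\oplus\cdots\oplus y_m=0\},$$ $$S_2=\{(x_1,\dots,x_n,y_1,\dots,y_m)\mid (x_1,\dots,x_n)\in S_{\mathcal N}\text{ and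 } y_1\oplus\cdots\oplus y_m=1\}.$$
   Context: Digraph Yama Nim on a finite digraph $G=(V,E)$: a position assigns a non-negative integer number of tokens to each vertex. On a turn, a player chooses a vertex $v$ and removes at least $d_{\mathrm{out}}(v)+1$ tokens from $v$ (where $d_{\mathrm{out}}(v)$ is the out-degree of $v$), and simultaneously adds one token to each out-neighbour of $v$; other counts are unchanged. Normal play: the player making the last move wins. A $\mathcal{P}$-position is one where the previous player has a winning strategy; an $\mathcal{N}$-position is one where the player to move has a winning strategy. $\oplus$ denotes bitwise XOR (nim-sum). -}

module Defs where

open import Data.Nat.Base using (ℕ; zero; suc; _+_; _*_; _∸_; _≤_; _/_; _%_; _≡ᵇ_)
open import Data.Bool.Base using (Bool; true; false; if_then_else_)
open import Data.Fin.Base using (Fin)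
open import Data.Fin.Properties using (_≟_)
open import Data.List.Base using (List; map; foldr)
open import Data.Nat.ListAction using (sum)
open import Data.List.Base using (allFin)
open import Data.Product.Base using (Σ; _×_)
open import Relation.Nullary.Decidable using (does)
open import Relation.Binary.PropositionalEquality using (_≡_)

-- Bitwise XOR (nim-sum) on ℕ, computed bit by bit.
-- The fuel a + b is always enough (every nonzero step halves a and b).

xorFuel : ℕ → ℕ → ℕ → ℕ
xorFuel zero    a b = 0
xorFuel (suc f) a b =
  (if (a % 2) ≡ᵇ (b % 2) then 0 else 1) + 2 * xorFuel f (a / 2) (b / 2)

_⊕_ : ℕ → ℕ → ℕ
a ⊕ b = xorFuel (a + b) a b

nimSum : {m : ℕ} → (Fin m → ℕ) → ℕ
nimSum {m} y = foldr _⊕_ 0 (map y (allFin m))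

b2n : Bool → ℕ
b2n true = 1
b2n false = 0

Digraph : ℕ → Set
Digraph k = Fin k → Fin k → Bool

outdeg : {k : ℕ} → Digraph k → Fin k → ℕ
outdeg {k} E v = sum (map (λ u → b2n (E v u)) (allFin k))

Pos : ℕ → Set
Pos k = Fin k → ℕ

Move : {k : ℕ} → Digraph k → (Fin k → ℕ) → Pos k → Pos k → Set
Move {k} E t p q =
  Σ (Fin k) λ v → Σ ℕ λ r →
    (suc (t v) ≤ r) × (r ≤ p v) ×
    ((u : Fin k) → q u ≡ (p u ∸ (if does (u ≟ v) then r else 0)) + b2n (E v u))

YamaMove : {k : ℕ} → Digraph k → Pos k → Pos k → Set
YamaMove E = Move E (outdeg E)

mutual
  data IsP {A : Set} (M : A → A → Set) (p : A) : Set where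
    isP : ((q : A) → M p q → IsN M q) → IsP M p

  data IsN {A : Set} (M : A → A → Set) (p : A) : Set where
    isN : (q : A) → M p q → IsP M q → IsN M p

{-# OPTIONS --safe #-}
-- Split a position into x (tokens on V₁) and y (tokens on W₁). A move at wⱼ is a plain nim
-- move on y that leaves x alone; a move at vᵢ is a move of the auxiliary game on x that adds
-- one token to every wⱼ. We show that S₁ ∪ S₂ is a kernel of the move relation (no move
-- inside it, and a move into it from everywhere else); in a well-founded game that is exactly
-- the set of P-positions.
--   No move inside: for m even, adding one token to every heap keeps the parity of the nim-sum
-- and sends nim-sum 1 to at least 2, because yⱼ ⊕ (yⱼ + 1) = 2ᵏ⁺¹ - 1 is odd with second
-- digit the parity of yⱼ.
--   A move into it: from (P-position, nim-sum ≠ 0) Bouton's move to nim-sum 0; from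
-- (N-position, nim-sum ≥ 2) Bouton's move to nim-sum 1; from (N-position, nim-sum 0) take one
-- token from an odd heap, or, if all heaps are even, play the auxiliary winning move, which
-- keeps the nim-sum 0.
module Submission where

open import Defs
open import Algebra.Bundles using (CommutativeMonoid)
open import Algebra.Structures using (IsCommutativeMonoid)
open import Data.Bool.Base using (false; true; if_then_else_)
open import Data.Fin.Base using (Fin; zero; suc; _↑ˡ_; _↑ʳ_; splitAt; punchIn)
open import Data.Fin.Properties
  using (any?; punchInᵢ≢i; ↑ˡ-injective; ↑ʳ-injective; splitAt-↑ˡ; splitAt-↑ʳ) renaming (_≟_ to _≟ᶠ_)
open import Data.List.Base using (foldr; map; allFin; tabulate)
open import Data.List.Properties using (map-tabulate)
open import Data.Nat.Base using (ℕ; zero; suc; _+_; _*_; _∸_; _≤_; _<_; _/_; _%_; _≡ᵇ_; z≤n; s≤s)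
open import Data.Nat.DivMod
  using (m%n<n; m≡m%n+[m/n]*n; [m+kn]%n≡m%n; +-distrib-/-∣ʳ; m*n/n≡m; m/n<m; m/n≤m; /-monoˡ-≤)
open import Data.Nat.Divisibility using (_∣_; divides)
open import Data.Nat.Induction using (<-rec; <-wellFounded)
open import Data.Nat.Properties
open import Data.Product.Base using (Σ; ∃; _×_; _,_; proj₁; proj₂)
open import Data.Sum.Base using (_⊎_; inj₁; inj₂; [_,_]′)
open import Data.Vec.Functional using (_++_)
import Data.Vec.Functional as Vector
open import Function.Base using (flip; id; _∘_)
open import Function.Bundles using (_⇔_; mk⇔)
import Function.Properties.Equivalence as ⇔
open import Induction.WellFounded using (WellFounded; Acc; acc; module Subrelation)
open import Level using (0ℓ)
import Relation.Binary.Construct.On as On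
open import Relation.Binary.PropositionalEquality
open import Relation.Nullary using (¬_; Dec; yes; no; does; contradiction)
open import Relation.Nullary.Decidable using (dec-true; dec-false; does-⇔)
open import Relation.Unary using (Decidable)
open import Algebra.Properties.CommutativeMonoid.Sum +-0-commutativeMonoid
  using (∑-distrib-+) renaming (sum to ∑; sum-cong-≗ to ∑-cong)
open import Algebra.Properties.CommutativeSemigroup +-commutativeSemigroup using (xy∙z≈xz∙y)

-- Binary digits and the nim-sum

data Bit : ℕ → Set where
  bit₀ : Bit 0
  bit₁ : Bit 1

parity : ∀ a → Bit (a % 2)
parity a with a % 2 | m%n<n a 2
... | 0 | _ = bit₀
... | 1 | _ = bit₁
... | suc (suc _) | s≤s (s≤s ())

parity-cases : ∀ a → a % 2 ≡ 0 ⊎ a % 2 ≡ 1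
parity-cases a with a % 2 | parity a
... | _ | bit₀ = inj₁ refl
... | _ | bit₁ = inj₂ refl

m≡m%2+[m/2]*2 : ∀ a → a ≡ a % 2 + (a / 2) * 2
m≡m%2+[m/2]*2 a = m≡m%n+[m/n]*n a 2

bits-injective : ∀ {a b} → a % 2 ≡ b % 2 → a / 2 ≡ b / 2 → a ≡ b
bits-injective {a} {b} a%2≡b%2 a/2≡b/2 =
  trans (m≡m%2+[m/2]*2 a) (trans (cong₂ (λ r q → r + q * 2) a%2≡b%2 a/2≡b/2) (sym (m≡m%2+[m/2]*2 b)))

[b+k*2]%2≡b : ∀ {b} → Bit b → ∀ k → (b + k * 2) % 2 ≡ b
[b+k*2]%2≡b bit₀ k = [m+kn]%n≡m%n 0 k 2
[b+k*2]%2≡b bit₁ k = [m+kn]%n≡m%n 1 k 2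

[b+k*2]/2≡k : ∀ {b} → Bit b → ∀ k → (b + k * 2) / 2 ≡ k
[b+k*2]/2≡k {b} β k = trans (+-distrib-/-∣ʳ b (divides k refl)) (cong₂ _+_ (b/2≡0 β) (m*n/n≡m k 2))
  where
  b/2≡0 : ∀ {b} → Bit b → b / 2 ≡ 0
  b/2≡0 bit₀ = refl
  b/2≡0 bit₁ = refl

m≤1+n⇒m/2≤n : ∀ {a f} → a ≤ suc f → a / 2 ≤ f
m≤1+n⇒m/2≤n {zero} _ = z≤n
m≤1+n⇒m/2≤n {suc a} a≤1+f = ≤-pred (≤-trans (m/n<m (suc a) 2 (s≤s (s≤s z≤n))) a≤1+f)

halving-induction : (P : ℕ → Set) → P 0 → (∀ n → P (n / 2) → P n) → ∀ n → P n
halving-induction P base step = <-rec P λ where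
  zero    _   → base
  (suc n) rec → step (suc n) (rec (m/n<m (suc n) 2 (s≤s (s≤s z≤n))))

xorFuel-irrelevant : ∀ {f g a b} → a ≤ f → b ≤ f → a ≤ g → b ≤ g → xorFuel f a b ≡ xorFuel g a b
xorFuel-irrelevant {zero}  {zero}  _   _   _   _   = refl
xorFuel-irrelevant {zero}  {suc g} z≤n z≤n _   _   = cong (2 *_) (xorFuel-irrelevant {zero} {g} z≤n z≤n z≤n z≤n)
xorFuel-irrelevant {suc f} {zero}  _   _   z≤n z≤n = cong (2 *_) (xorFuel-irrelevant {f} {zero} z≤n z≤n z≤n z≤n)
xorFuel-irrelevant {suc f} {suc g} {a} {b} a≤f b≤f a≤g b≤g =
  cong (λ x → (if (a % 2) ≡ᵇ (b % 2) then 0 else 1) + 2 * x)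
       (xorFuel-irrelevant (m≤1+n⇒m/2≤n a≤f) (m≤1+n⇒m/2≤n b≤f) (m≤1+n⇒m/2≤n a≤g) (m≤1+n⇒m/2≤n b≤g))

⊕-bit : ∀ {x y} → Bit x → Bit y → Bit (x ⊕ y)
⊕-bit bit₀ bit₀ = bit₀
⊕-bit bit₀ bit₁ = bit₁
⊕-bit bit₁ bit₀ = bit₁
⊕-bit bit₁ bit₁ = bit₀

⊕-unfold : ∀ a b → a ⊕ b ≡ ((a % 2) ⊕ (b % 2)) + ((a / 2) ⊕ (b / 2)) * 2
⊕-unfold a b = begin
  xorFuel (a + b) a b
    ≡⟨ xorFuel-irrelevant (m≤m+n a b) (m≤n+m b a) (m≤n⇒m≤1+n (m≤m+n a b)) (m≤n⇒m≤1+n (m≤n+m b a)) ⟩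
  (if a % 2 ≡ᵇ b % 2 then 0 else 1) + 2 * xorFuel (a + b) (a / 2) (b / 2)
    ≡⟨ cong₂ _+_ (lowest-bit (parity a) (parity b)) (*-comm 2 (xorFuel (a + b) (a / 2) (b / 2))) ⟩
  ((a % 2) ⊕ (b % 2)) + xorFuel (a + b) (a / 2) (b / 2) * 2
    ≡⟨ cong (λ x → ((a % 2) ⊕ (b % 2)) + x * 2) (xorFuel-irrelevant a/2≤a+b b/2≤a+b (m≤m+n _ _) (m≤n+m _ _)) ⟩
  ((a % 2) ⊕ (b % 2)) + ((a / 2) ⊕ (b / 2)) * 2 ∎
  where
  open ≡-Reasoning
  a/2≤a+b : a / 2 ≤ a + b
  a/2≤a+b = ≤-trans (m/n≤m a 2) (m≤m+n a b)
  b/2≤a+b : b / 2 ≤ a + b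
  b/2≤a+b = ≤-trans (m/n≤m b 2) (m≤n+m b a)
  lowest-bit : ∀ {x y} → Bit x → Bit y → (if x ≡ᵇ y then 0 else 1) ≡ x ⊕ y
  lowest-bit bit₀ bit₀ = refl
  lowest-bit bit₀ bit₁ = refl
  lowest-bit bit₁ bit₀ = refl
  lowest-bit bit₁ bit₁ = refl

⊕-%2 : ∀ a b → (a ⊕ b) % 2 ≡ (a % 2) ⊕ (b % 2)
⊕-%2 a b = trans (cong (_% 2) (⊕-unfold a b)) ([b+k*2]%2≡b (⊕-bit (parity a) (parity b)) ((a / 2) ⊕ (b / 2)))

⊕-/2 : ∀ a b → (a ⊕ b) / 2 ≡ (a / 2) ⊕ (b / 2)
⊕-/2 a b = trans (cong (_/ 2) (⊕-unfold a b)) ([b+k*2]/2≡k (⊕-bit (parity a) (parity b)) ((a / 2) ⊕ (b / 2)))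

⊕-identityˡ : ∀ a → 0 ⊕ a ≡ a
⊕-identityˡ = halving-induction (λ a → 0 ⊕ a ≡ a) refl λ a ih →
  bits-injective (trans (⊕-%2 0 a) (bit-identityˡ (parity a))) (trans (⊕-/2 0 a) ih)
  where
  bit-identityˡ : ∀ {x} → Bit x → 0 ⊕ x ≡ x
  bit-identityˡ bit₀ = refl
  bit-identityˡ bit₁ = refl

⊕-identityʳ : ∀ a → a ⊕ 0 ≡ a
⊕-identityʳ = halving-induction (λ a → a ⊕ 0 ≡ a) refl λ a ih →
  bits-injective (trans (⊕-%2 a 0) (bit-identityʳ (parity a))) (trans (⊕-/2 a 0) ih)
  where
  bit-identityʳ : ∀ {x} → Bit x → x ⊕ 0 ≡ x
  bit-identityʳ bit₀ = refl
  bit-identityʳ bit₁ = refl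

⊕-self : ∀ a → a ⊕ a ≡ 0
⊕-self = halving-induction (λ a → a ⊕ a ≡ 0) refl λ a ih →
  bits-injective (trans (⊕-%2 a a) (bit-self (parity a))) (trans (⊕-/2 a a) ih)
  where
  bit-self : ∀ {x} → Bit x → x ⊕ x ≡ 0
  bit-self bit₀ = refl
  bit-self bit₁ = refl

⊕-comm : ∀ a b → a ⊕ b ≡ b ⊕ a
⊕-comm = halving-induction (λ a → ∀ b → a ⊕ b ≡ b ⊕ a)
  (λ b → trans (⊕-identityˡ b) (sym (⊕-identityʳ b))) λ a ih b →
  bits-injective
    (trans (⊕-%2 a b) (trans (bit-comm (parity a) (parity b)) (sym (⊕-%2 b a))))
    (trans (⊕-/2 a b) (trans (ih (b / 2)) (sym (⊕-/2 b a))))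
  where
  bit-comm : ∀ {x y} → Bit x → Bit y → x ⊕ y ≡ y ⊕ x
  bit-comm bit₀ bit₀ = refl
  bit-comm bit₀ bit₁ = refl
  bit-comm bit₁ bit₀ = refl
  bit-comm bit₁ bit₁ = refl

⊕-assoc : ∀ a b c → (a ⊕ b) ⊕ c ≡ a ⊕ (b ⊕ c)
⊕-assoc = halving-induction (λ a → ∀ b c → (a ⊕ b) ⊕ c ≡ a ⊕ (b ⊕ c))
  (λ b c → trans (cong (_⊕ c) (⊕-identityˡ b)) (sym (⊕-identityˡ (b ⊕ c)))) λ a ih b c →
  bits-injective
    (begin
      ((a ⊕ b) ⊕ c) % 2                 ≡⟨ ⊕-%2 (a ⊕ b) c ⟩
      ((a ⊕ b) % 2) ⊕ (c % 2)           ≡⟨ cong (_⊕ (c % 2)) (⊕-%2 a b) ⟩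
      ((a % 2) ⊕ (b % 2)) ⊕ (c % 2)     ≡⟨ bit-assoc (parity a) (parity b) (parity c) ⟩
      (a % 2) ⊕ ((b % 2) ⊕ (c % 2))     ≡⟨ cong ((a % 2) ⊕_) (⊕-%2 b c) ⟨
      (a % 2) ⊕ ((b ⊕ c) % 2)           ≡⟨ ⊕-%2 a (b ⊕ c) ⟨
      (a ⊕ (b ⊕ c)) % 2                 ∎)
    (begin
      ((a ⊕ b) ⊕ c) / 2                 ≡⟨ ⊕-/2 (a ⊕ b) c ⟩
      ((a ⊕ b) / 2) ⊕ (c / 2)           ≡⟨ cong (_⊕ (c / 2)) (⊕-/2 a b) ⟩
      ((a / 2) ⊕ (b / 2)) ⊕ (c / 2)     ≡⟨ ih (b / 2) (c / 2) ⟩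
      (a / 2) ⊕ ((b / 2) ⊕ (c / 2))     ≡⟨ cong ((a / 2) ⊕_) (⊕-/2 b c) ⟨
      (a / 2) ⊕ ((b ⊕ c) / 2)           ≡⟨ ⊕-/2 a (b ⊕ c) ⟨
      (a ⊕ (b ⊕ c)) / 2                 ∎)
  where
  open ≡-Reasoning
  bit-assoc : ∀ {x y z} → Bit x → Bit y → Bit z → (x ⊕ y) ⊕ z ≡ x ⊕ (y ⊕ z)
  bit-assoc bit₀ bit₀ bit₀ = refl
  bit-assoc bit₀ bit₀ bit₁ = refl
  bit-assoc bit₀ bit₁ bit₀ = refl
  bit-assoc bit₀ bit₁ bit₁ = refl
  bit-assoc bit₁ bit₀ bit₀ = refl
  bit-assoc bit₁ bit₀ bit₁ = refl
  bit-assoc bit₁ bit₁ bit₀ = refl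
  bit-assoc bit₁ bit₁ bit₁ = refl

⊕-cancelˡ : ∀ a b → a ⊕ (a ⊕ b) ≡ b
⊕-cancelˡ a b = trans (sym (⊕-assoc a a b)) (trans (cong (_⊕ b) (⊕-self a)) (⊕-identityˡ b))

⊕≡0⇒≡ : ∀ {a b} → a ⊕ b ≡ 0 → a ≡ b
⊕≡0⇒≡ {a} {b} a⊕b≡0 = trans (sym (⊕-identityʳ a)) (trans (cong (a ⊕_) (sym a⊕b≡0)) (⊕-cancelˡ a b))

⊕-isCommutativeMonoid : IsCommutativeMonoid _≡_ _⊕_ 0
⊕-isCommutativeMonoid = record
  { isMonoid = record
    { isSemigroup = record { isMagma = isMagma _⊕_ ; assoc = ⊕-assoc }
    ; identity    = ⊕-identityˡ , ⊕-identityʳ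
    }
  ; comm = ⊕-comm
  }

⊕-commutativeMonoid : CommutativeMonoid 0ℓ 0ℓ
⊕-commutativeMonoid = record { isCommutativeMonoid = ⊕-isCommutativeMonoid }

open import Algebra.Properties.CommutativeMonoid.Sum ⊕-commutativeMonoid
  using () renaming (sum to ⨁; sum-cong-≗ to ⨁-cong; sum-remove to ⨁-remove;
                     sum-replicate-zero to ⨁-replicate-zero; ∑-distrib-+ to ⨁-distrib-⊕)
open import Algebra.Properties.CommutativeSemigroup (CommutativeMonoid.commutativeSemigroup ⊕-commutativeMonoid)
  using (interchange)

⨁-hom : (h : ℕ → ℕ) → h 0 ≡ 0 → (∀ a b → h (a ⊕ b) ≡ h a ⊕ h b) →
        ∀ {m} (y : Fin m → ℕ) → h (⨁ y) ≡ ⨁ (h ∘ y)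
⨁-hom h h0 h⊕ {zero}  y = h0
⨁-hom h h0 h⊕ {suc m} y = trans (h⊕ (y zero) (⨁ (y ∘ suc))) (cong (h (y zero) ⊕_) (⨁-hom h h0 h⊕ (y ∘ suc)))

⨁-/2 : ∀ {m} (y : Fin m → ℕ) → ⨁ y / 2 ≡ ⨁ (λ j → y j / 2)
⨁-/2 = ⨁-hom (_/ 2) refl ⊕-/2

⨁-%2 : ∀ {m} (y : Fin m → ℕ) → ⨁ y % 2 ≡ ⨁ (λ j → y j % 2)
⨁-%2 = ⨁-hom (_% 2) refl ⊕-%2

⨁-update : ∀ {m} {y y′ : Fin m → ℕ} j → (∀ l → l ≢ j → y′ l ≡ y l) → ⨁ y ⊕ ⨁ y′ ≡ y j ⊕ y′ j
⨁-update {suc m} {y} {y′} j agree = begin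
  ⨁ y ⊕ ⨁ y′                ≡⟨ cong₂ _⊕_ (⨁-remove {i = j} y) (⨁-remove {i = j} y′) ⟩
  (y j ⊕ R) ⊕ (y′ j ⊕ R′)   ≡⟨ cong (λ r → (y j ⊕ R) ⊕ (y′ j ⊕ r)) R′≡R ⟩
  (y j ⊕ R) ⊕ (y′ j ⊕ R)    ≡⟨ interchange (y j) R (y′ j) R ⟩
  (y j ⊕ y′ j) ⊕ (R ⊕ R)    ≡⟨ cong ((y j ⊕ y′ j) ⊕_) (⊕-self R) ⟩
  (y j ⊕ y′ j) ⊕ 0          ≡⟨ ⊕-identityʳ (y j ⊕ y′ j) ⟩
  y j ⊕ y′ j                ∎
  where
  open ≡-Reasoning
  R R′ : ℕ
  R = ⨁ (y ∘ punchIn j)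
  R′ = ⨁ (y′ ∘ punchIn j)
  R′≡R : R′ ≡ R
  R′≡R = ⨁-cong (λ l → agree (punchIn j l) (punchInᵢ≢i j l))

⨁-update-⊕ : ∀ {m} {y y′ : Fin m → ℕ} j {d} → (∀ l → l ≢ j → y′ l ≡ y l) → y′ j ≡ y j ⊕ d → ⨁ y′ ≡ ⨁ y ⊕ d
⨁-update-⊕ {y = y} {y′} j {d} agree y′ⱼ≡ = begin
  ⨁ y′                   ≡⟨ ⊕-cancelˡ (⨁ y) (⨁ y′) ⟨
  ⨁ y ⊕ (⨁ y ⊕ ⨁ y′)     ≡⟨ cong (⨁ y ⊕_) (⨁-update j agree) ⟩
  ⨁ y ⊕ (y j ⊕ y′ j)     ≡⟨ cong (λ z → ⨁ y ⊕ (y j ⊕ z)) y′ⱼ≡ ⟩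
  ⨁ y ⊕ (y j ⊕ (y j ⊕ d)) ≡⟨ cong (⨁ y ⊕_) (⊕-cancelˡ (y j) d) ⟩
  ⨁ y ⊕ d                ∎
  where open ≡-Reasoning

⨁-update-< : ∀ {m} {y y′ : Fin m → ℕ} j → (∀ l → l ≢ j → y′ l ≡ y l) → y′ j < y j → ⨁ y′ ≢ ⨁ y
⨁-update-< {y = y} {y′} j agree y′ⱼ<yⱼ ⨁y′≡⨁y = <-irrefl y′ⱼ≡yⱼ y′ⱼ<yⱼ
  where
  y′ⱼ≡yⱼ : y′ j ≡ y j
  y′ⱼ≡yⱼ = sym (⊕≡0⇒≡ (trans (sym (⨁-update j agree)) (trans (cong (⨁ y ⊕_) ⨁y′≡⨁y) (⊕-self (⨁ y)))))

⨁-const-even : ∀ {m} → 2 ∣ m → ∀ c → ⨁ {m} (λ _ → c) ≡ 0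
⨁-const-even (divides q refl) c = go q
  where
  go : ∀ q → ⨁ {q * 2} (λ _ → c) ≡ 0
  go zero    = refl
  go (suc q) = trans (⊕-cancelˡ c _) (go q)

odd-or-all-even : ∀ {m} (y : Fin m → ℕ) → (∃ λ j → y j % 2 ≡ 1) ⊎ (∀ j → y j % 2 ≡ 0)
odd-or-all-even y with any? (λ j → y j % 2 ≟ 1)
... | yes odd = inj₁ odd
... | no ¬odd = inj₂ λ j → [ id , (λ odd → contradiction (j , odd) ¬odd) ]′ (parity-cases (y j))

⨁-odd : ∀ {m} (y : Fin m → ℕ) → ⨁ y % 2 ≡ 1 → ∃ λ j → y j % 2 ≡ 1
⨁-odd {m} y ⨁y-odd with odd-or-all-even y
... | inj₁ odd  = odd
... | inj₂ even with () ← trans (sym ⨁y-odd) (trans (⨁-%2 y) (trans (⨁-cong even) (⨁-replicate-zero m)))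

-- Bouton's move

-- TopBit d c: the leading binary digit of d is also a digit of c.
data TopBit : ℕ → ℕ → Set where
  here  : ∀ {c} → c % 2 ≡ 1 → TopBit 1 c
  there : ∀ {d c} → TopBit (d / 2) (c / 2) → TopBit d c

TopBit⇒⊕-< : ∀ {d c} → TopBit d c → c ⊕ d < c
TopBit⇒⊕-< {c = c} (here c-odd) = begin-strict
  c ⊕ 1                                   ≡⟨ ⊕-unfold c 1 ⟩
  ((c % 2) ⊕ 1) + ((c / 2) ⊕ 0) * 2       ≡⟨ cong₂ (λ r q → (r ⊕ 1) + q * 2) c-odd (⊕-identityʳ (c / 2)) ⟩
  (c / 2) * 2                             <⟨ n<1+n _ ⟩
  1 + (c / 2) * 2                         ≡⟨ cong (_+ (c / 2) * 2) c-odd ⟨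
  c % 2 + (c / 2) * 2                     ≡⟨ m≡m%2+[m/2]*2 c ⟨
  c                                       ∎
  where open ≤-Reasoning
TopBit⇒⊕-< {d} {c} (there top) = begin-strict
  c ⊕ d                                   ≡⟨ ⊕-unfold c d ⟩
  ((c % 2) ⊕ (d % 2)) + ((c / 2) ⊕ (d / 2)) * 2
                                          ≤⟨ +-monoˡ-≤ _ (bit≤1 (⊕-bit (parity c) (parity d))) ⟩
  1 + ((c / 2) ⊕ (d / 2)) * 2             <⟨ n<1+n _ ⟩
  suc ((c / 2) ⊕ (d / 2)) * 2             ≤⟨ *-monoˡ-≤ 2 (TopBit⇒⊕-< top) ⟩
  (c / 2) * 2                             ≤⟨ m≤n+m _ (c % 2) ⟩
  c % 2 + (c / 2) * 2                     ≡⟨ m≡m%2+[m/2]*2 c ⟨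
  c                                       ∎
  where
  open ≤-Reasoning
  bit≤1 : ∀ {x} → Bit x → x ≤ 1
  bit≤1 bit₀ = z≤n
  bit≤1 bit₁ = s≤s z≤n

<⇒TopBit : ∀ {s c} → s < c → TopBit (c ⊕ s) c
<⇒TopBit {s} {c} = halving-induction (λ c → ∀ s → s < c → TopBit (c ⊕ s) c) (λ _ ()) step c s
  where
  step : ∀ c → (∀ s → s < c / 2 → TopBit ((c / 2) ⊕ s) (c / 2)) → ∀ s → s < c → TopBit (c ⊕ s) c
  step c ih s s<c with c / 2 ≟ s / 2
  ... | no  c/2≢s/2 =
    there (subst (λ d → TopBit d (c / 2)) (sym (⊕-/2 c s))
            (ih (s / 2) (≤∧≢⇒< (/-monoˡ-≤ 2 (<⇒≤ s<c)) (c/2≢s/2 ∘ sym))))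
  ... | yes c/2≡s/2 = subst (λ d → TopBit d c) (sym c⊕s≡1) (here c-odd)
    where
    lowest-bits : ∀ {x y} → Bit x → Bit y → x < y → x ≡ 0 × y ≡ 1
    lowest-bits bit₀ bit₁ _ = refl , refl
    lowest-bits bit₁ bit₁ (s≤s ())
    s%2<c%2 : s % 2 < c % 2
    s%2<c%2 = +-cancelʳ-< _ (s % 2) (c % 2)
      (subst₂ _<_ (trans (m≡m%2+[m/2]*2 s) (cong (λ q → s % 2 + q * 2) (sym c/2≡s/2))) (m≡m%2+[m/2]*2 c) s<c)
    s-even : s % 2 ≡ 0
    s-even = proj₁ (lowest-bits (parity s) (parity c) s%2<c%2)
    c-odd : c % 2 ≡ 1
    c-odd = proj₂ (lowest-bits (parity s) (parity c) s%2<c%2)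
    c⊕s≡1 : c ⊕ s ≡ 1
    c⊕s≡1 = bits-injective (trans (⊕-%2 c s) (cong₂ _⊕_ c-odd s-even))
                           (trans (⊕-/2 c s) (trans (cong (_⊕ (s / 2)) c/2≡s/2) (⊕-self (s / 2))))

TopBit-⨁ : ∀ {d c} → TopBit d c → ∀ {m} (y : Fin m → ℕ) → c ≡ ⨁ y → ∃ λ j → TopBit d (y j)
TopBit-⨁ (here c-odd) y refl with j , yj-odd ← ⨁-odd y c-odd = j , here yj-odd
TopBit-⨁ (there top)  y refl with j , topj ← TopBit-⨁ top (λ j → y j / 2) (⨁-/2 y) = j , there topj

-- Lowering heap j to y j ⊕ (⨁ y ⊕ s) turns the nim-sum into s.
nim-move : ∀ {m} (y : Fin m → ℕ) {s} → s < ⨁ y → ∃ λ j → y j ⊕ (⨁ y ⊕ s) < y j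
nim-move y s<⨁y with j , top ← TopBit-⨁ (<⇒TopBit s<⨁y) y refl = j , TopBit⇒⊕-< top

odd⇒⊕1-< : ∀ {a} → a % 2 ≡ 1 → a ⊕ 1 < a
odd⇒⊕1-< a-odd = TopBit⇒⊕-< (here a-odd)

-- Adding one token to every heap

suc-even : ∀ a → a % 2 ≡ 0 → suc a % 2 ≡ 1 × suc a / 2 ≡ a / 2
suc-even a a-even =
  trans (cong (_% 2) 1+a≡) ([b+k*2]%2≡b bit₁ (a / 2)) ,
  trans (cong (_/ 2) 1+a≡) ([b+k*2]/2≡k bit₁ (a / 2))
  where
  1+a≡ : suc a ≡ 1 + (a / 2) * 2
  1+a≡ = cong suc (trans (m≡m%2+[m/2]*2 a) (cong (_+ (a / 2) * 2) a-even))

suc-odd : ∀ a → a % 2 ≡ 1 → suc a % 2 ≡ 0 × suc a / 2 ≡ suc (a / 2)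
suc-odd a a-odd =
  trans (cong (_% 2) 1+a≡) ([b+k*2]%2≡b bit₀ (suc (a / 2))) ,
  trans (cong (_/ 2) 1+a≡) ([b+k*2]/2≡k bit₀ (suc (a / 2)))
  where
  1+a≡ : suc a ≡ 0 + suc (a / 2) * 2
  1+a≡ = cong suc (trans (m≡m%2+[m/2]*2 a) (cong (_+ (a / 2) * 2) a-odd))

even⇒suc≡⊕1 : ∀ a → a % 2 ≡ 0 → suc a ≡ a ⊕ 1
even⇒suc≡⊕1 a a-even = bits-injective
  (trans (proj₁ (suc-even a a-even)) (sym (trans (⊕-%2 a 1) (cong (_⊕ 1) a-even))))
  (trans (proj₂ (suc-even a a-even)) (sym (trans (⊕-/2 a 1) (⊕-identityʳ (a / 2)))))

-- a ⊕ suc a = 2ᵏ⁺¹ - 1 where k is the number of trailing ones of a.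
[a⊕suc-a]%2≡1 : ∀ a → (a ⊕ suc a) % 2 ≡ 1
[a⊕suc-a]%2≡1 a with parity-cases a
... | inj₁ a-even = trans (⊕-%2 a (suc a)) (cong₂ _⊕_ a-even (proj₁ (suc-even a a-even)))
... | inj₂ a-odd  = trans (⊕-%2 a (suc a)) (cong₂ _⊕_ a-odd (proj₁ (suc-odd a a-odd)))

[a⊕suc-a]/2%2≡a%2 : ∀ a → ((a ⊕ suc a) / 2) % 2 ≡ a % 2
[a⊕suc-a]/2%2≡a%2 a with parity-cases a
... | inj₁ a-even = begin
  ((a ⊕ suc a) / 2) % 2          ≡⟨ cong (_% 2) (⊕-/2 a (suc a)) ⟩
  ((a / 2) ⊕ (suc a / 2)) % 2    ≡⟨ cong (λ h → ((a / 2) ⊕ h) % 2) (proj₂ (suc-even a a-even)) ⟩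
  ((a / 2) ⊕ (a / 2)) % 2        ≡⟨ cong (_% 2) (⊕-self (a / 2)) ⟩
  0                              ≡⟨ a-even ⟨
  a % 2                          ∎
  where open ≡-Reasoning
... | inj₂ a-odd = begin
  ((a ⊕ suc a) / 2) % 2          ≡⟨ cong (_% 2) (⊕-/2 a (suc a)) ⟩
  ((a / 2) ⊕ (suc a / 2)) % 2    ≡⟨ cong (λ h → ((a / 2) ⊕ h) % 2) (proj₂ (suc-odd a a-odd)) ⟩
  ((a / 2) ⊕ suc (a / 2)) % 2    ≡⟨ [a⊕suc-a]%2≡1 (a / 2) ⟩
  1                              ≡⟨ a-odd ⟨
  a % 2                          ∎
  where open ≡-Reasoning

module _ {m} (m-even : 2 ∣ m) (y : Fin m → ℕ) where

  private
    δ : Fin m → ℕ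
    δ j = y j ⊕ suc (y j)

    ⨁-suc : ⨁ (suc ∘ y) ≡ ⨁ y ⊕ ⨁ δ
    ⨁-suc = trans (⨁-cong (λ j → sym (⊕-cancelˡ (y j) (suc (y j))))) (⨁-distrib-⊕ y δ)

    ⨁δ-even : ⨁ δ % 2 ≡ 0
    ⨁δ-even = trans (⨁-%2 δ) (trans (⨁-cong (λ j → [a⊕suc-a]%2≡1 (y j))) (⨁-const-even m-even 1))

    ⨁δ/2-parity : (⨁ δ / 2) % 2 ≡ ⨁ y % 2
    ⨁δ/2-parity = begin
      (⨁ δ / 2) % 2                   ≡⟨ cong (_% 2) (⨁-/2 δ) ⟩
      ⨁ (λ j → δ j / 2) % 2           ≡⟨ ⨁-%2 (λ j → δ j / 2) ⟩
      ⨁ (λ j → (δ j / 2) % 2)         ≡⟨ ⨁-cong (λ j → [a⊕suc-a]/2%2≡a%2 (y j)) ⟩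
      ⨁ (λ j → y j % 2)               ≡⟨ ⨁-%2 y ⟨
      ⨁ y % 2                         ∎
      where open ≡-Reasoning

  ⨁-suc-parity : ⨁ (suc ∘ y) % 2 ≡ ⨁ y % 2
  ⨁-suc-parity = begin
    ⨁ (suc ∘ y) % 2                   ≡⟨ cong (_% 2) ⨁-suc ⟩
    (⨁ y ⊕ ⨁ δ) % 2                   ≡⟨ ⊕-%2 (⨁ y) (⨁ δ) ⟩
    (⨁ y % 2) ⊕ (⨁ δ % 2)             ≡⟨ cong ((⨁ y % 2) ⊕_) ⨁δ-even ⟩
    (⨁ y % 2) ⊕ 0                     ≡⟨ ⊕-identityʳ (⨁ y % 2) ⟩
    ⨁ y % 2                           ∎
    where open ≡-Reasoning

  ⨁-suc-≢1 : ⨁ y ≡ 1 → ⨁ (suc ∘ y) ≢ 1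
  ⨁-suc-≢1 ⨁y≡1 ⨁suc≡1 = 0≢1+n (begin
    0                                 ≡⟨ cong (λ x → (x / 2) % 2) ⨁suc≡1 ⟨
    (⨁ (suc ∘ y) / 2) % 2             ≡⟨ cong (λ x → (x / 2) % 2) ⨁-suc ⟩
    ((⨁ y ⊕ ⨁ δ) / 2) % 2             ≡⟨ cong (_% 2) (⊕-/2 (⨁ y) (⨁ δ)) ⟩
    ((⨁ y / 2) ⊕ (⨁ δ / 2)) % 2       ≡⟨ cong (λ x → ((x / 2) ⊕ (⨁ δ / 2)) % 2) ⨁y≡1 ⟩
    (0 ⊕ (⨁ δ / 2)) % 2               ≡⟨ cong (_% 2) (⊕-identityˡ (⨁ δ / 2)) ⟩
    (⨁ δ / 2) % 2                     ≡⟨ ⨁δ/2-parity ⟩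
    ⨁ y % 2                           ≡⟨ cong (_% 2) ⨁y≡1 ⟩
    1                                 ∎)
    where open ≡-Reasoning

  ⨁-suc-all-even : (∀ j → y j % 2 ≡ 0) → ⨁ (suc ∘ y) ≡ ⨁ y
  ⨁-suc-all-even all-even = begin
    ⨁ (suc ∘ y)                       ≡⟨ ⨁-cong (λ j → even⇒suc≡⊕1 (y j) (all-even j)) ⟩
    ⨁ (λ j → y j ⊕ 1)                 ≡⟨ ⨁-distrib-⊕ y (λ _ → 1) ⟩
    ⨁ y ⊕ ⨁ {m} (λ _ → 1)             ≡⟨ cong (⨁ y ⊕_) (⨁-const-even m-even 1) ⟩
    ⨁ y ⊕ 0                           ≡⟨ ⊕-identityʳ (⨁ y) ⟩
    ⨁ y                               ∎
    where open ≡-Reasoning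

-- Kernels of well-founded games

module _ {A : Set} {M : A → A → Set} where

  IsP⇒¬IsN : ∀ {p} → IsP M p → ¬ IsN M p
  IsP⇒¬IsN (isP allN) (isN q mv Pq) = IsP⇒¬IsN Pq (allN q mv)

  module _ (wf : WellFounded (flip M)) {K : A → Set} (K? : Decidable K)
           (independent : ∀ {p q} → K p → M p q → ¬ K q)
           (absorbing : ∀ {p} → ¬ K p → ∃ λ q → M p q × K q) where

    private
      classify : ∀ p → Acc (flip M) p → (K p → IsP M p) × (¬ K p → IsN M p)
      classify p (acc rs) = inK , outK
        where
        inK : K p → IsP M p
        inK Kp = isP λ q mv → proj₂ (classify q (rs mv)) (independent Kp mv)
        outK : ¬ K p → IsN M p
        outK ¬Kp with q , mv , Kq ← absorbing ¬Kp = isN q mv (proj₁ (classify q (rs mv)) Kq)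

    IsP⇔kernel : ∀ p → IsP M p ⇔ K p
    IsP⇔kernel p = mk⇔ toK (proj₁ (classify p (wf p)))
      where
      toK : IsP M p → K p
      toK Pp with K? p
      ... | yes Kp  = Kp
      ... | no  ¬Kp = contradiction (proj₂ (classify p (wf p)) ¬Kp) (IsP⇒¬IsN Pp)

foldr-map-allFin : ∀ {A B : Set} (_∙_ : A → B → B) e {k} (f : Fin k → A) →
                   foldr _∙_ e (map f (allFin k)) ≡ Vector.foldr _∙_ e f
foldr-map-allFin {A} _∙_ e {k} f = trans (cong (foldr _∙_ e) (map-tabulate id f)) (foldr-tabulate f)
  where
  foldr-tabulate : ∀ {k} (f : Fin k → A) → foldr _∙_ e (tabulate f) ≡ Vector.foldr _∙_ e f
  foldr-tabulate {zero}  f = refl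
  foldr-tabulate {suc k} f = cong (f zero ∙_) (foldr-tabulate (f ∘ suc))

outdeg≡∑ : ∀ {k} (E : Digraph k) v → outdeg E v ≡ ∑ (λ u → b2n (E v u))
outdeg≡∑ E v = foldr-map-allFin _+_ 0 (λ u → b2n (E v u))

take : ∀ {k} → Fin k → ℕ → Fin k → ℕ
take v r u = if does (u ≟ᶠ v) then r else 0

take-self : ∀ {k} (v : Fin k) r → take v r v ≡ r
take-self v r = cong (λ b → if b then r else 0) (dec-true (v ≟ᶠ v) refl)

take-≢ : ∀ {k} {u v : Fin k} r → u ≢ v → take v r u ≡ 0
take-≢ {u = u} {v} r u≢v = cong (λ b → if b then r else 0) (dec-false (u ≟ᶠ v) u≢v)

take-injective : ∀ {k l} {f : Fin k → Fin l} → (∀ {a b} → f a ≡ f b → a ≡ b) →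
                 ∀ v r u → take (f v) r (f u) ≡ take v r u
take-injective {f = f} f-inj v r u =
  cong (λ b → if b then r else 0) (does-⇔ (mk⇔ f-inj (cong f)) (f u ≟ᶠ f v) (u ≟ᶠ v))

after : ∀ {k} → Digraph k → Pos k → Fin k → ℕ → Pos k
after E p v r u = (p u ∸ take v r u) + b2n (E v u)

module _ {k} {E : Digraph k} {t : Fin k → ℕ} where

  Move-resp : ∀ {p p′ q} → (∀ u → p u ≡ p′ u) → Move E t p q → Move E t p′ q
  Move-resp p≗p′ (v , r , lo , hi , q≗) =
    v , r , lo , subst (r ≤_) (p≗p′ v) hi , λ u → trans (q≗ u) (cong (λ x → (x ∸ take v r u) + _) (p≗p′ u))

  IsP-resp : ∀ {p p′} → (∀ u → p u ≡ p′ u) → IsP (Move E t) p → IsP (Move E t) p′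
  IsP-resp p≗p′ (isP allN) = isP λ q mv → allN q (Move-resp (sym ∘ p≗p′) mv)

  IsN-resp : ∀ {p p′} → (∀ u → p u ≡ p′ u) → IsN (Move E t) p → IsN (Move E t) p′
  IsN-resp p≗p′ (isN q mv Pq) = isN q (Move-resp p≗p′ mv) Pq

∑-take : ∀ {k} (p : Pos k) v {r} → r ≤ p v → ∑ (λ u → p u ∸ take v r u) + r ≡ ∑ p
∑-take p zero    {r} r≤p₀ =
  trans (xy∙z≈xz∙y (p zero ∸ r) (∑ (p ∘ suc)) r) (cong (_+ ∑ (p ∘ suc)) (m∸n+n≡m r≤p₀))
∑-take p (suc v) {r} r≤pᵥ = trans (+-assoc (p zero) _ r) (cong (p zero +_) (∑-take (p ∘ suc) v r≤pᵥ))

module _ {k} {E : Digraph k} {t : Fin k → ℕ} (outdeg≤t : ∀ v → outdeg E v ≤ t v) where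

  Move-decreases-∑ : ∀ {p q} → Move E t p q → ∑ q < ∑ p
  Move-decreases-∑ {p} {q} (v , r , lo , hi , q≗) = +-cancelʳ-< r (∑ q) (∑ p) (begin-strict
    ∑ q + r                 ≡⟨ cong (_+ r) (trans (∑-cong q≗) (∑-distrib-+ rest out)) ⟩
    ∑ rest + ∑ out + r      ≡⟨ xy∙z≈xz∙y (∑ rest) (∑ out) r ⟩
    ∑ rest + r + ∑ out      ≡⟨ cong (_+ ∑ out) (∑-take p v hi) ⟩
    ∑ p + ∑ out             <⟨ +-monoʳ-< (∑ p) (≤-<-trans (subst (_≤ t v) (outdeg≡∑ E v) (outdeg≤t v)) lo) ⟩
    ∑ p + r                 ∎)
    where
    open ≤-Reasoning
    rest out : Pos k
    rest u = p u ∸ take v r u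
    out u = b2n (E v u)

  Move-wellFounded : WellFounded (flip (Move E t))
  Move-wellFounded = Subrelation.wellFounded Move-decreases-∑ (On.wellFounded ∑ <-wellFounded)

  private
    module Successors (p : Pos k)
                      (successors-determined : ∀ {q} → Move E t p q → IsP (Move E t) q ⊎ IsN (Move E t) q) where

      WinningMove : Fin k → ℕ → Set
      WinningMove v r = Σ (t v < r) λ lo → Σ (r ≤ p v) λ hi → IsP (Move E t) (after E p v r)

      winning? : ∀ v r → Dec (WinningMove v r)
      winning? v r with t v <? r | r ≤? p v
      ... | no ¬lo | _      = no (¬lo ∘ proj₁)
      ... | yes _  | no ¬hi = no (¬hi ∘ proj₁ ∘ proj₂)
      ... | yes lo | yes hi with successors-determined (v , r , lo , hi , λ _ → refl)
      ...   | inj₁ P = yes (lo , hi , P)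
      ...   | inj₂ N = no λ (_ , _ , P) → IsP⇒¬IsN P N

      losing : ¬ (∃ λ v → ∃ λ r → r < suc (p v) × WinningMove v r) → ∀ q → Move E t p q → IsN (Move E t) q
      losing no-win q (v , r , lo , hi , q≗) with successors-determined (v , r , lo , hi , λ _ → refl)
      ... | inj₁ P = contradiction (v , r , s≤s hi , lo , hi , P) no-win
      ... | inj₂ N = IsN-resp (sym ∘ q≗) N

      determined : IsP (Move E t) p ⊎ IsN (Move E t) p
      determined with any? (λ v → anyUpTo? (winning? v) (suc (p v)))
      ... | yes (v , r , _ , lo , hi , P) = inj₂ (isN (after E p v r) (v , r , lo , hi , λ _ → refl) P)
      ... | no no-win                     = inj₁ (isP (losing no-win))

  Move-determined : ∀ p → IsP (Move E t) p ⊎ IsN (Move E t) p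
  Move-determined p = go p (Move-wellFounded p)
    where
    go : ∀ p → Acc (flip (Move E t)) p → IsP (Move E t) p ⊎ IsN (Move E t) p
    go p (acc rs) = Successors.determined p (λ mv → go _ (rs mv))

≤-∑ : ∀ {k} (f : Fin k → ℕ) u → f u ≤ ∑ f
≤-∑ f zero    = m≤m+n (f zero) _
≤-∑ f (suc u) = ≤-trans (≤-∑ (f ∘ suc) u) (m≤n+m _ (f zero))

∑-↑ : ∀ n {m} (f : Fin (n + m) → ℕ) → ∑ f ≡ ∑ (λ i → f (i ↑ˡ m)) + ∑ (λ j → f (n ↑ʳ j))
∑-↑ zero    f = refl
∑-↑ (suc n) f = trans (cong (f zero +_) (∑-↑ n (f ∘ suc))) (sym (+-assoc (f zero) _ _))

↑ˡ≢↑ʳ : ∀ {n m} (i : Fin n) (j : Fin m) → i ↑ˡ m ≢ n ↑ʳ j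
↑ˡ≢↑ʳ {n} {m} i j i≡j
  with () ← trans (sym (splitAt-↑ˡ n i m)) (trans (cong (splitAt n) i≡j) (splitAt-↑ʳ n m j))

data Side (n m : ℕ) : Fin (n + m) → Set where
  inV : (i : Fin n) → Side n m (i ↑ˡ m)
  inW : (j : Fin m) → Side n m (n ↑ʳ j)

side : ∀ n m v → Side n m v
side zero    m v       = inW v
side (suc n) m zero    = inV zero
side (suc n) m (suc v) with side n m v
... | inV i = inV (suc i)
... | inW j = inW j

after-sink : ∀ {k} {E : Digraph k} {v} → (∀ u → E v u ≡ false) → ∀ p r u → after E p v r u ≡ p u ∸ take v r u
after-sink sink p r u = trans (cong (λ b → _ + b2n b) (sink u)) (+-identityʳ _)

module Bipartite (n m : ℕ) (E : Digraph (n + m))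
                 (V→W : ∀ i j → E (i ↑ˡ m) (n ↑ʳ j) ≡ true)
                 (W-sink : ∀ j → outdeg E (n ↑ʳ j) ≡ 0)
                 (m-even : 2 ∣ m) where

  Eᵥ : Digraph n
  Eᵥ i k = E (i ↑ˡ m) (k ↑ˡ m)

  tᵥ : Fin n → ℕ
  tᵥ i = outdeg E (i ↑ˡ m)

  Aux : Pos n → Pos n → Set
  Aux = Move Eᵥ tᵥ

  onV : Pos (n + m) → Pos n
  onV p i = p (i ↑ˡ m)

  onW : Pos (n + m) → Fin m → ℕ
  onW p j = p (n ↑ʳ j)

  W-no-edges : ∀ j u → E (n ↑ʳ j) u ≡ false
  W-no-edges j u = b2n≤0 (subst (b2n (E (n ↑ʳ j) u) ≤_) (trans (sym (outdeg≡∑ E _)) (W-sink j)) (≤-∑ _ u))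
    where
    b2n≤0 : ∀ {b} → b2n b ≤ 0 → b ≡ false
    b2n≤0 {false} _ = refl

  outdegᵥ≤tᵥ : ∀ i → outdeg Eᵥ i ≤ tᵥ i
  outdegᵥ≤tᵥ i = begin
    outdeg Eᵥ i                                  ≡⟨ outdeg≡∑ Eᵥ i ⟩
    ∑ (λ k → b2n (Eᵥ i k))                       ≤⟨ m≤m+n _ _ ⟩
    ∑ (λ k → b2n (Eᵥ i k)) + ∑ (λ j → b2n (E (i ↑ˡ m) (n ↑ʳ j)))
                                                 ≡⟨ ∑-↑ n _ ⟨
    ∑ (λ u → b2n (E (i ↑ˡ m) u))                 ≡⟨ outdeg≡∑ E (i ↑ˡ m) ⟨
    tᵥ i                                         ∎
    where open ≤-Reasoning

  after-V-onV : ∀ p i r k → after E p (i ↑ˡ m) r (k ↑ˡ m) ≡ after Eᵥ (onV p) i r k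
  after-V-onV p i r k =
    cong (λ x → (p (k ↑ˡ m) ∸ x) + b2n (Eᵥ i k)) (take-injective (↑ˡ-injective m _ _) i r k)

  after-V-onW : ∀ p i r j → after E p (i ↑ˡ m) r (n ↑ʳ j) ≡ suc (onW p j)
  after-V-onW p i r j = trans (cong₂ (λ x b → (onW p j ∸ x) + b2n b) (take-≢ r (↑ˡ≢↑ʳ i j ∘ sym)) (V→W i j))
                              (+-comm (onW p j) 1)

  after-W-onV : ∀ p j r k → after E p (n ↑ʳ j) r (k ↑ˡ m) ≡ onV p k
  after-W-onV p j r k = trans (after-sink {E = E} (W-no-edges j) p r (k ↑ˡ m))
                              (cong (onV p k ∸_) (take-≢ r (↑ˡ≢↑ʳ k j)))

  after-W-onW : ∀ p j r l → after E p (n ↑ʳ j) r (n ↑ʳ l) ≡ onW p l ∸ take j r l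
  after-W-onW p j r l = trans (after-sink {E = E} (W-no-edges j) p r (n ↑ʳ l))
                              (cong (onW p l ∸_) (take-injective (↑ʳ-injective n _ _) j r l))

  data Step (p q : Pos (n + m)) : Set where
    stepV : Aux (onV p) (onV q) → (∀ j → onW q j ≡ suc (onW p j)) → Step p q
    stepW : ∀ j → (∀ k → onV q k ≡ onV p k) →
            (∀ l → l ≢ j → onW q l ≡ onW p l) → onW q j < onW p j → Step p q

  step : ∀ {p q} → YamaMove E p q → Step p q
  step {p} {q} (v , r , lo , hi , q≗) with side n m v
  ... | inV i = stepV (i , r , lo , hi , λ k → trans (q≗ (k ↑ˡ m)) (after-V-onV p i r k))
                      (λ j → trans (q≗ (n ↑ʳ j)) (after-V-onW p i r j))
  ... | inW j = stepW j (λ k → trans (q≗ (k ↑ˡ m)) (after-W-onV p j r k))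
                        (λ l l≢j → trans (q≗ (n ↑ʳ l))
                                         (trans (after-W-onW p j r l) (cong (onW p l ∸_) (take-≢ r l≢j))))
                        (begin-strict
                          onW q j                ≡⟨ trans (q≗ (n ↑ʳ j)) (after-W-onW p j r j) ⟩
                          onW p j ∸ take j r j   ≡⟨ cong (onW p j ∸_) (take-self j r) ⟩
                          onW p j ∸ r            <⟨ ∸-monoʳ-< (≤-trans (s≤s z≤n) lo) hi ⟩
                          onW p j                ∎)
    where open ≤-Reasoning

  liftV : ∀ p {x′} → Aux (onV p) x′ →
          ∃ λ q → YamaMove E p q × (∀ k → onV q k ≡ x′ k) × (∀ j → onW q j ≡ suc (onW p j))
  liftV p (i , r , lo , hi , x′≗) =
    after E p (i ↑ˡ m) r , (i ↑ˡ m , r , lo , hi , λ _ → refl) ,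
    (λ k → trans (after-V-onV p i r k) (sym (x′≗ k))) , after-V-onW p i r

  lowerW : ∀ p j {d} → onW p j ⊕ d < onW p j →
           ∃ λ q → YamaMove E p q × (∀ k → onV q k ≡ onV p k) × ⨁ (onW q) ≡ ⨁ (onW p) ⊕ d
  lowerW p j {d} lower =
    q , (n ↑ʳ j , r , lo , m∸n≤m _ z , λ _ → refl) , after-W-onV p j r , ⨁-update-⊕ j others qⱼ≡z
    where
    z r : ℕ
    z = onW p j ⊕ d
    r = onW p j ∸ z
    q : Pos (n + m)
    q = after E p (n ↑ʳ j) r
    lo : suc (outdeg E (n ↑ʳ j)) ≤ r
    lo = subst (λ o → suc o ≤ r) (sym (W-sink j)) (m<n⇒0<n∸m lower)
    others : ∀ l → l ≢ j → onW q l ≡ onW p l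
    others l l≢j = trans (after-W-onW p j r l) (cong (onW p l ∸_) (take-≢ r l≢j))
    qⱼ≡z : onW q j ≡ z
    qⱼ≡z = trans (after-W-onW p j r j) (trans (cong (onW p j ∸_) (take-self j r)) (m∸[m∸n]≡n (<⇒≤ lower)))

  -- S₁ ∪ S₂ of the paper, with the tokens on W recorded only through their nim-sum.
  S₁∪S₂ : Pos n → ℕ → Set
  S₁∪S₂ x s = (IsP Aux x × s ≡ 0) ⊎ (IsN Aux x × s ≡ 1)

  S₁∪S₂-resp : ∀ {x x′ s s′} → (∀ k → x k ≡ x′ k) → s ≡ s′ → S₁∪S₂ x s → S₁∪S₂ x′ s′
  S₁∪S₂-resp x≗x′ refl (inj₁ (P , s≡0)) = inj₁ (IsP-resp x≗x′ P , s≡0)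
  S₁∪S₂-resp x≗x′ refl (inj₂ (N , s≡1)) = inj₂ (IsN-resp x≗x′ N , s≡1)

  S₁∪S₂-functional : ∀ {x x′ s s′} → (∀ k → x k ≡ x′ k) → S₁∪S₂ x s → S₁∪S₂ x′ s′ → s ≡ s′
  S₁∪S₂-functional _    (inj₁ (_ , s≡0)) (inj₁ (_  , s′≡0)) = trans s≡0 (sym s′≡0)
  S₁∪S₂-functional _    (inj₂ (_ , s≡1)) (inj₂ (_  , s′≡1)) = trans s≡1 (sym s′≡1)
  S₁∪S₂-functional x≗x′ (inj₁ (P , _))   (inj₂ (N′ , _))    = contradiction N′ (IsP⇒¬IsN (IsP-resp x≗x′ P))
  S₁∪S₂-functional x≗x′ (inj₂ (N , _))   (inj₁ (P′ , _))    = contradiction (IsN-resp x≗x′ N) (IsP⇒¬IsN P′)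

  S₁∪S₂? : ∀ x s → Dec (S₁∪S₂ x s)
  S₁∪S₂? x s with Move-determined outdegᵥ≤tᵥ x | s ≟ 0 | s ≟ 1
  ... | inj₁ P | yes s≡0 | _       = yes (inj₁ (P , s≡0))
  ... | inj₂ N | _       | yes s≡1 = yes (inj₂ (N , s≡1))
  ... | inj₁ P | no s≢0  | _       = no λ { (inj₁ (_ , s≡0)) → s≢0 s≡0 ; (inj₂ (N , _)) → IsP⇒¬IsN P N }
  ... | inj₂ N | _       | no s≢1  = no λ { (inj₂ (_ , s≡1)) → s≢1 s≡1 ; (inj₁ (P , _)) → IsP⇒¬IsN P N }

  Kernel : Pos (n + m) → Set
  Kernel p = S₁∪S₂ (onV p) (⨁ (onW p))

  ⨁-stepV-parity : ∀ {p q} → (∀ j → onW q j ≡ suc (onW p j)) → ⨁ (onW q) % 2 ≡ ⨁ (onW p) % 2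
  ⨁-stepV-parity {p} sucW = trans (cong (_% 2) (⨁-cong sucW)) (⨁-suc-parity m-even (onW p))

  independentV : ∀ {p q} → Aux (onV p) (onV q) → (∀ j → onW q j ≡ suc (onW p j)) → Kernel p → ¬ Kernel q
  independentV aux sucW (inj₁ (isP allN , _)) (inj₁ (P′ , _)) = IsP⇒¬IsN P′ (allN _ aux)
  independentV {p} {q} aux sucW (inj₁ (_ , ⨁≡0)) (inj₂ (_ , ⨁′≡1))
    with () ← trans (cong (_% 2) (sym ⨁≡0)) (trans (sym (⨁-stepV-parity {p} {q} sucW)) (cong (_% 2) ⨁′≡1))
  independentV {p} {q} aux sucW (inj₂ (_ , ⨁≡1)) (inj₁ (_ , ⨁′≡0))
    with () ← trans (cong (_% 2) (sym ⨁′≡0)) (trans (⨁-stepV-parity {p} {q} sucW) (cong (_% 2) ⨁≡1))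
  independentV {p} aux sucW (inj₂ (_ , ⨁≡1)) (inj₂ (_ , ⨁′≡1)) =
    ⨁-suc-≢1 m-even (onW p) ⨁≡1 (trans (sym (⨁-cong sucW)) ⨁′≡1)

  independent : ∀ {p q} → Kernel p → YamaMove E p q → ¬ Kernel q
  independent {p} {q} Kp mv Kq with step mv
  ... | stepW j same others lower = ⨁-update-< j others lower (S₁∪S₂-functional same Kq Kp)
  ... | stepV aux sucW = independentV {p} {q} aux sucW Kp Kq

  toNimSum : ∀ p {s} → s < ⨁ (onW p) → ∃ λ q → YamaMove E p q × (∀ k → onV q k ≡ onV p k) × ⨁ (onW q) ≡ s
  toNimSum p {s} s<⨁ =
    let j , lower = nim-move (onW p) s<⨁
        q , mv , same , ⨁q≡ = lowerW p j lower
    in q , mv , same , trans ⨁q≡ (⊕-cancelˡ (⨁ (onW p)) s)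

  absorbingN : ∀ {p} → IsN Aux (onV p) → ⨁ (onW p) ≢ 1 → ∃ λ q → YamaMove E p q × Kernel q
  absorbingN {p} N ⨁≢1 with ⨁ (onW p) in ⨁≡ | odd-or-all-even (onW p)
  ... | 1           | _ = contradiction refl ⨁≢1
  ... | suc (suc _) | _ =
    let q , mv , same , ⨁q≡1 = toNimSum p (subst (1 <_) (sym ⨁≡) (s≤s (s≤s z≤n)))
    in q , mv , inj₂ (IsN-resp (sym ∘ same) N , ⨁q≡1)
  ... | 0 | inj₁ (j , odd) =
    let q , mv , same , ⨁q≡ = lowerW p j (odd⇒⊕1-< odd)
    in q , mv , inj₂ (IsN-resp (sym ∘ same) N , trans ⨁q≡ (cong (_⊕ 1) ⨁≡))
  ... | 0 | inj₂ all-even with N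
  ...   | isN x′ aux P′ =
    let q , mv , x′≗ , sucW = liftV p aux
    in q , mv , inj₁ (IsP-resp (sym ∘ x′≗) P′ ,
                      trans (⨁-cong sucW) (trans (⨁-suc-all-even m-even (onW p) all-even) ⨁≡))

  absorbing : ∀ {p} → ¬ Kernel p → ∃ λ q → YamaMove E p q × Kernel q
  absorbing {p} ¬Kp with Move-determined outdegᵥ≤tᵥ (onV p)
  ... | inj₂ N = absorbingN N (¬Kp ∘ inj₂ ∘ (N ,_))
  ... | inj₁ P =
    let q , mv , same , ⨁q≡0 = toNimSum p (n≢0⇒n>0 (¬Kp ∘ inj₁ ∘ (P ,_)))
    in q , mv , inj₁ (IsP-resp (sym ∘ same) P , ⨁q≡0)

  IsP⇔Kernel : ∀ p → IsP (YamaMove E) p ⇔ Kernel p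
  IsP⇔Kernel = IsP⇔kernel (Move-wellFounded {E = E} {t = outdeg E} (λ _ → ≤-refl))
                          (λ p → S₁∪S₂? (onV p) (⨁ (onW p))) independent absorbing

theorem9 : (n m : ℕ) (E : Digraph (n + m)) →
    ((v : Fin (n + m)) → E v v ≡ false) →
    ((i : Fin n) (j : Fin m) → E (i ↑ˡ m) (n ↑ʳ j) ≡ true) →
    ((j : Fin m) → outdeg E (n ↑ʳ j) ≡ 0) →
    2 ∣ m →
    (x : Fin n → ℕ) (y : Fin m → ℕ) →
    IsP (YamaMove E) (x ++ y)
      ⇔ ((IsP (Move (λ i j → E (i ↑ˡ m) (j ↑ˡ m)) (λ i → outdeg E (i ↑ˡ m))) x
            × nimSum y ≡ 0)
         ⊎ (IsN (Move (λ i j → E (i ↑ˡ m) (j ↑ˡ m)) (λ i → outdeg E (i ↑ˡ m))) x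
            × nimSum y ≡ 1))
theorem9 n m E _ V→W W-sink m-even x y =
  ⇔.trans (IsP⇔Kernel (x ++ y)) (mk⇔ (S₁∪S₂-resp onV-++ ⨁-++) (S₁∪S₂-resp (sym ∘ onV-++) (sym ⨁-++)))
  where
  open Bipartite n m E V→W W-sink m-even
  onV-++ : ∀ k → onV (x ++ y) k ≡ x k
  onV-++ k = cong [ x , y ]′ (splitAt-↑ˡ n k m)
  ⨁-++ : ⨁ (onW (x ++ y)) ≡ nimSum y
  ⨁-++ = trans (⨁-cong (λ j → cong [ x , y ]′ (splitAt-↑ʳ n m j))) (sym (foldr-map-allFin _⊕_ 0 y))
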